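{- For every integer $a\ge 3$, $\beta_b(C(3a;1,a))=\alpha(C(3a;1,a))=a$.
   Context: For integers $n\ge 3$ and $1\le a\le\lfloor n/2\rfloor$, the circulant graph $C(n;1,a)$ has vertex set $\{v_0,\dots,v_{n-1}\}$ and edges $v_iv_{i+1}$ and $v_iv_{i+a}$, subscripts modulo $n$. For a connected graph $G$, a broadcast is a function $f:V(G)\to\{0,\dots,\mathrm{diam}(G)\}$ with $f(v)\le e(v)$ (eccentricity) for all $v$; $V_f^+=\{v:f(v)>0\}$. $f$ is independent if $d(u,v)>\max\{f(u),f(v)\}$ for all distinct $u,v\in V_f^+$. The cost is $\sigma(f)=\sum_v f(v)$, and $\beta_b(G)$ is the maximum cost of an independent broadcast on $G$. $\alpha(G)$ denotes the independence number. -}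

module Defs where

open import Data.Nat using (ℕ; zero; suc; _+_; _*_; _≤_; _<_; _⊔_)
open import Data.Fin using (Fin; toℕ)
open import Data.Fin.Subset using (Subset; _∈_; ∣_∣)
open import Data.List using (map; allFin)
open import Data.Nat.ListAction using (sum)
open import Data.Product using (Σ; _×_; ∃)
open import Data.Sum using (_⊎_)
open import Relation.Nullary using (¬_)
open import Relation.Binary.PropositionalEquality using (_≡_; _≢_)

-- i + s ≡ j (mod n), for i j : Fin n and 0 < s < n, written out explicitly.
AddMod : (n s : ℕ) → Fin n → Fin n → Set
AddMod n s i j = (toℕ i + s ≡ toℕ j) ⊎ (toℕ i + s ≡ toℕ j + n)

Adj : (n a : ℕ) → Fin n → Fin n → Set
Adj n a u v = AddMod n 1 u v ⊎ AddMod n 1 v u ⊎ AddMod n a u v ⊎ AddMod n a v u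

-- Reach n a u v k : there is a walk from u to v of length at most k,
-- i.e. d(u,v) ≤ k.
data Reach (n a : ℕ) : Fin n → Fin n → ℕ → Set where
  here : ∀ {u k} → Reach n a u u k
  step : ∀ {u w v k} → Adj n a u w → Reach n a w v k → Reach n a u v (suc k)

DistGt : (n a : ℕ) → Fin n → Fin n → ℕ → Set
DistGt n a u v m = ¬ Reach n a u v m

LeEcc : (n a : ℕ) → ℕ → Fin n → Set
LeEcc n a m v = ∃ λ u → ∀ k → Reach n a v u k → m ≤ k

IsBroadcast : (n a : ℕ) → (Fin n → ℕ) → Set
IsBroadcast n a f = ∀ v → LeEcc n a (f v) v

IsIndependentBroadcast : (n a : ℕ) → (Fin n → ℕ) → Set
IsIndependentBroadcast n a f =
  IsBroadcast n a f ×
  (∀ u v → u ≢ v → 0 < f u → 0 < f v → DistGt n a u v (f u ⊔ f v))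

cost : (n : ℕ) → (Fin n → ℕ) → ℕ
cost n f = sum (map f (allFin n))

BroadcastIndepNumber : (n a m : ℕ) → Set
BroadcastIndepNumber n a m =
  (Σ (Fin n → ℕ) λ f → IsIndependentBroadcast n a f × cost n f ≡ m) ×
  (∀ f → IsIndependentBroadcast n a f → cost n f ≤ m)

IsIndependentSet : (n a : ℕ) → Subset n → Set
IsIndependentSet n a S = ∀ u v → u ∈ S → v ∈ S → ¬ Adj n a u v

IndepNumber : (n a m : ℕ) → Set
IndepNumber n a m =
  (Σ (Subset n) λ S → IsIndependentSet n a S × ∣ S ∣ ≡ m) ×
  (∀ S → IsIndependentSet n a S → ∣ S ∣ ≤ m)

{-# OPTIONS --safe #-}
module Submission where

-- Write each vertex as v_(r + q·a) with residue r < a and layer q < 3. Walking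
-- m steps along 1-edges adds m to the residue, and the three vertices of equal
-- residue form a triangle of a-edges, so d(u,v) ≤ m + 1 whenever
-- r(u) + m ≡ r(v) (mod a); in particular every eccentricity is at most a.
-- A broadcasting vertex v thus claims the residues r(v) + i (mod a), i < f(v),
-- and independence makes these claims disjoint: r(u) + i ≡ r(v) + j with
-- j ≤ i < f(u) gives d(u,v) ≤ i − j + 1 ≤ f(u). Double counting gives σ(f) ≤ a;
-- as the indicator of an independent set is an independent broadcast, also α ≤ a.
-- Conversely, the residue-r vertex of layer (r mod 2), for each r < a, gives an
-- independent set of size a.

open import Defs
open import Data.Bool using (Bool; true; false)
open import Data.Empty using (⊥-elim)
open import Data.Fin using (Fin; zero; suc; toℕ; fromℕ<; _↑ˡ_; _↑ʳ_; combine)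
import Data.Fin.Properties as Fin
open import Data.Fin.Properties using (toℕ-fromℕ<; toℕ-injective; toℕ<n; toℕ-combine)
open import Data.Fin.Subset using (Subset; _∈_; ∣_∣)
import Data.List as List
open import Data.List.Properties using (map-tabulate)
import Data.Nat.ListAction as ListAction
open import Data.Nat
  using (ℕ; zero; suc; _+_; _*_; _∸_; _%_; _/_; _≤_; _<_; _⊔_; z≤n; s≤s; NonZero; >-nonZero⁻¹; _≟_; _<?_)
open import Data.Nat.DivMod
open import Data.Nat.Divisibility using (n∣m*n; ∣-refl)
open import Data.Nat.Properties
import Data.Product
open import Data.Product using (_×_; _,_; proj₁; proj₂; ∃)
open import Data.Sum using (_⊎_; inj₁; inj₂)
open import Data.Vec using (lookup; tabulate; []; _∷_)
open import Data.Vec.Properties using (lookup∘tabulate; []=⇒lookup; lookup⇒[]=)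
open import Function using (id; _∘_)
open import Relation.Nullary using (Dec; yes; no; does; ¬_)
open import Relation.Binary.PropositionalEquality
open import Algebra.Properties.CommutativeMonoid.Sum +-0-commutativeMonoid
  using (sum; sum-syntax; sum-cong-≗; ∑-comm; sum-replicate-zero)

𝟙 : Bool → ℕ
𝟙 true  = 1
𝟙 false = 0

𝟙≤1 : ∀ b → 𝟙 b ≤ 1
𝟙≤1 true  = ≤-refl
𝟙≤1 false = z≤n

𝟙-pos : ∀ {b} → 0 < 𝟙 b → b ≡ true
𝟙-pos {true} _ = refl

𝟙-does-pos : ∀ {P : Set} (P? : Dec P) → 0 < 𝟙 (does P?) → P
𝟙-does-pos (yes p) _ = p

∑-mono-≤ : ∀ {n} (f g : Fin n → ℕ) → (∀ i → f i ≤ g i) → sum f ≤ sum g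
∑-mono-≤ {zero}  f g f≤g = z≤n
∑-mono-≤ {suc n} f g f≤g =
  +-mono-≤ (f≤g zero) (∑-mono-≤ (f ∘ suc) (g ∘ suc) (f≤g ∘ suc))

∑-const-1 : ∀ n → ∑[ i < n ] 1 ≡ n
∑-const-1 zero    = refl
∑-const-1 (suc n) = cong suc (∑-const-1 n)

∑-δ : ∀ {n p} → p < n → ∑[ i < n ] 𝟙 (does (toℕ i ≟ p)) ≡ 1
∑-δ {suc n} {zero}  _         = cong suc (sum-replicate-zero n)
∑-δ {suc n} {suc p} (s≤s p<n) = ∑-δ p<n

∑-pos⇒∃ : ∀ {n} (f : Fin n → ℕ) → 0 < sum f → ∃ λ i → 0 < f i
∑-pos⇒∃ {suc n} f 0<∑ with f zero in eq
... | suc _ = zero , subst (0 <_) (sym eq) (s≤s z≤n)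
... | zero  = let i , 0<fi = ∑-pos⇒∃ (f ∘ suc) 0<∑ in suc i , 0<fi

∑-≤1 : ∀ {n} (f : Fin n → ℕ) → (∀ i → f i ≤ 1) →
       (∀ i j → 0 < f i → 0 < f j → i ≡ j) → sum f ≤ 1
∑-≤1 {zero}  f f≤1 unique = z≤n
∑-≤1 {suc n} f f≤1 unique with f zero in eq
... | zero  = ∑-≤1 (f ∘ suc) (f≤1 ∘ suc)
                (λ i j p q → Fin.suc-injective (unique (suc i) (suc j) p q))
... | suc _ = +-mono-≤ (subst (_≤ 1) eq (f≤1 zero))
                (≤-trans (∑-mono-≤ (f ∘ suc) (λ _ → 0) rest≤0) (≤-reflexive (sum-replicate-zero n)))
  where
  rest≤0 : ∀ i → f (suc i) ≤ 0
  rest≤0 i = ≮⇒≥ λ 0<fi → 0≢1+n (cong toℕ (unique zero (suc i) (subst (0 <_) (sym eq) (s≤s z≤n)) 0<fi))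

∑-≤-disjoint : ∀ {m k} (f : Fin m → ℕ) (ρ : (v : Fin m) → Fin (f v) → ℕ) →
               (∀ v i → ρ v i < k) →
               (∀ u v i j → ρ u i ≡ ρ v j → u ≡ v × toℕ i ≡ toℕ j) →
               sum f ≤ k
∑-≤-disjoint {m} {k} f ρ ρ<k ρ-injective = begin
  ∑[ v < m ] f v                                     ≡⟨ sum-cong-≗ (λ v → ∑-const-1 (f v)) ⟨
  ∑[ v < m ] ∑[ i < f v ] 1                          ≡⟨ sum-cong-≗ (λ v → sum-cong-≗ (λ i → ∑-δ (ρ<k v i))) ⟨
  ∑[ v < m ] ∑[ i < f v ] ∑[ r < k ] hit r v i       ≡⟨ sum-cong-≗ (λ v → ∑-comm (λ i r → hit r v i)) ⟩
  ∑[ v < m ] ∑[ r < k ] ∑[ i < f v ] hit r v i       ≡⟨ ∑-comm (λ v r → ∑[ i < f v ] hit r v i) ⟩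
  ∑[ r < k ] ∑[ v < m ] ∑[ i < f v ] hit r v i       ≤⟨ ∑-mono-≤ _ (λ _ → 1) hits≤1 ⟩
  ∑[ r < k ] 1                                       ≡⟨ ∑-const-1 k ⟩
  k                                                  ∎
  where
  open ≤-Reasoning
  hit : Fin k → (v : Fin m) → Fin (f v) → ℕ
  hit r v i = 𝟙 (does (toℕ r ≟ ρ v i))
  hit⇒ : ∀ r {v i} → 0 < hit r v i → ρ v i ≡ toℕ r
  hit⇒ r {v} {i} = sym ∘ 𝟙-does-pos (toℕ r ≟ ρ v i)
  hits≤1 : ∀ r → ∑[ v < m ] ∑[ i < f v ] hit r v i ≤ 1
  hits≤1 r = ∑-≤1 (λ v → ∑[ i < f v ] hit r v i)
               (λ v → ∑-≤1 (hit r v) (λ i → 𝟙≤1 _) (λ i j p q → toℕ-injective (proj₂ (same p q))))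
               (λ u v p q → let i , p = ∑-pos⇒∃ (hit r u) p ; j , q = ∑-pos⇒∃ (hit r v) q in proj₁ (same p q))
    where
    same : ∀ {u v i j} → 0 < hit r u i → 0 < hit r v j → u ≡ v × toℕ i ≡ toℕ j
    same p q = ρ-injective _ _ _ _ (trans (hit⇒ r p) (sym (hit⇒ r q)))

∑-↑ : ∀ m {k} (g : Fin (m + k) → ℕ) →
      sum g ≡ ∑[ i < m ] g (i ↑ˡ k) + ∑[ j < k ] g (m ↑ʳ j)
∑-↑ zero    g = refl
∑-↑ (suc m) g = trans (cong (g zero +_) (∑-↑ m (g ∘ suc))) (sym (+-assoc (g zero) _ _))

∑-combine : ∀ m {k} (g : Fin (m * k) → ℕ) → sum g ≡ ∑[ i < m ] ∑[ j < k ] g (combine i j)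
∑-combine zero        g = refl
∑-combine (suc m) {k} g =
  trans (∑-↑ k g) (cong (∑[ j < k ] g (j ↑ˡ m * k) +_) (∑-combine m (g ∘ (k ↑ʳ_))))

cost≡∑ : ∀ n f → cost n f ≡ ∑[ v < n ] f v
cost≡∑ n f = trans (cong ListAction.sum (map-tabulate id f)) (sum-tabulate f)
  where
  sum-tabulate : ∀ {m} (g : Fin m → ℕ) → ListAction.sum (List.tabulate g) ≡ sum g
  sum-tabulate {zero}  g = refl
  sum-tabulate {suc m} g = cong (g zero +_) (sum-tabulate (g ∘ suc))

∣p∣≡∑ : ∀ {n} (p : Subset n) → ∣ p ∣ ≡ ∑[ i < n ] 𝟙 (lookup p i)
∣p∣≡∑ []          = refl
∣p∣≡∑ (true ∷ p)  = cong suc (∣p∣≡∑ p)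
∣p∣≡∑ (false ∷ p) = ∣p∣≡∑ p

∈-tabulate⁻ : ∀ {n} {P : Fin n → Set} (P? : ∀ v → Dec (P v)) {v} → v ∈ tabulate (does ∘ P?) → P v
∈-tabulate⁻ P? {v} v∈ with P? v | trans (sym (lookup∘tabulate (does ∘ P?) v)) ([]=⇒lookup v∈)
... | yes p | _ = p

[m%n+k]%n≡[m+k]%n : ∀ m k n .{{_ : NonZero n}} → (m % n + k) % n ≡ (m + k) % n
[m%n+k]%n≡[m+k]%n m k n = begin
  (m % n + k) % n          ≡⟨ %-distribˡ-+ (m % n) k n ⟩
  (m % n % n + k % n) % n  ≡⟨ cong (λ x → (x + k % n) % n) (m%n%n≡m%n m n) ⟩
  (m % n + k % n) % n      ≡⟨ %-distribˡ-+ m k n ⟨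
  (m + k) % n              ∎
  where open ≡-Reasoning

%-cancelʳ-+ : ∀ {m o} k n .{{_ : NonZero n}} → (m + k) % n ≡ (o + k) % n → m % n ≡ o % n
%-cancelʳ-+ {m} {o} k n eq = begin
  m % n                    ≡⟨ undo m ⟨
  ((m + k) % n + c) % n    ≡⟨ cong (λ x → (x + c) % n) eq ⟩
  ((o + k) % n + c) % n    ≡⟨ undo o ⟩
  o % n                    ∎
  where
  open ≡-Reasoning
  -- adding k and then c adds the multiple k * n
  c = k * n ∸ k
  undo : ∀ x → ((x + k) % n + c) % n ≡ x % n
  undo x = begin
    ((x + k) % n + c) % n  ≡⟨ [m%n+k]%n≡[m+k]%n (x + k) c n ⟩
    (x + k + c) % n        ≡⟨ cong (_% n) (trans (+-assoc x k c) (cong (x +_) (m+[n∸m]≡n (m≤m*n k n)))) ⟩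
    (x + k * n) % n        ≡⟨ [m+kn]%n≡m%n x k n ⟩
    x % n                  ∎

[m+d]%n≡m%n⇒d≡0 : ∀ m {d} n .{{_ : NonZero n}} → d < n → (m + d) % n ≡ m % n → d ≡ 0
[m+d]%n≡m%n⇒d≡0 m {d} n d<n eq = begin
  d          ≡⟨ m<n⇒m%n≡m d<n ⟨
  d % n      ≡⟨ %-cancelʳ-+ m n (trans (cong (_% n) (+-comm d m)) eq) ⟩
  0 % n      ≡⟨ m*n%n≡0 0 n ⟩
  0          ∎
  where open ≡-Reasoning

[m+kn]/n≡k : ∀ {m} k n .{{_ : NonZero n}} → m < n → (m + k * n) / n ≡ k
[m+kn]/n≡k {m} k n m<n = begin
  (m + k * n) / n        ≡⟨ +-distrib-/ m (k * n) no-carry ⟩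
  m / n + k * n / n      ≡⟨ cong₂ _+_ (m<n⇒m/n≡0 m<n) (m*n/n≡m k n) ⟩
  k                      ∎
  where
  open ≡-Reasoning
  no-carry : m % n + k * n % n < n
  no-carry = subst (_< n) (sym (trans (cong₂ _+_ (m<n⇒m%n≡m m<n) (m*n%n≡0 k n)) (+-identityʳ m))) m<n

module _ {n a : ℕ} where

  Adj-sym : ∀ {u v} → Adj n a u v → Adj n a v u
  Adj-sym (inj₁ e)                = inj₂ (inj₁ e)
  Adj-sym (inj₂ (inj₁ e))         = inj₁ e
  Adj-sym (inj₂ (inj₂ (inj₁ e)))  = inj₂ (inj₂ (inj₂ e))
  Adj-sym (inj₂ (inj₂ (inj₂ e)))  = inj₂ (inj₂ (inj₁ e))

  Reach-mono : ∀ {u v k m} → k ≤ m → Reach n a u v k → Reach n a u v m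
  Reach-mono _         here         = here
  Reach-mono (s≤s k≤m) (step uw wv) = step uw (Reach-mono k≤m wv)

  Reach-trans : ∀ {u w v k m} → Reach n a u w k → Reach n a w v m → Reach n a u v (k + m)
  Reach-trans {k = k} {m} here wv = Reach-mono (m≤n+m m k) wv
  Reach-trans (step ux xw) wv = step ux (Reach-trans xw wv)

  Reach-sym : ∀ {u v k} → Reach n a u v k → Reach n a v u k
  Reach-sym here = here
  Reach-sym (step {k = k} uw wv) =
    Reach-mono (≤-reflexive (+-comm k 1)) (Reach-trans (Reach-sym wv) (step (Adj-sym uw) here))

  Reach-0 : ∀ {u v} → Reach n a u v 0 → u ≡ v
  Reach-0 here = refl

  Reach-1 : ∀ {u v} → Reach n a u v 1 → u ≡ v ⊎ Adj n a u v
  Reach-1 here            = inj₁ refl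
  Reach-1 (step uw here)  = inj₂ uw

module _ {n : ℕ} .{{_ : NonZero n}} where

  infixl 6 _⊕_
  _⊕_ : Fin n → ℕ → Fin n
  u ⊕ m = fromℕ< (m%n<n (toℕ u + m) n)

  toℕ-⊕ : ∀ u m → toℕ (u ⊕ m) ≡ (toℕ u + m) % n
  toℕ-⊕ u m = toℕ-fromℕ< (m%n<n (toℕ u + m) n)

  ⊕-identityʳ : ∀ u → u ⊕ 0 ≡ u
  ⊕-identityʳ u = toℕ-injective
    (trans (toℕ-⊕ u 0) (trans (cong (_% n) (+-identityʳ (toℕ u))) (m<n⇒m%n≡m (toℕ<n u))))

  ⊕-assoc : ∀ u k m → u ⊕ k ⊕ m ≡ u ⊕ (k + m)
  ⊕-assoc u k m = toℕ-injective (begin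
    toℕ (u ⊕ k ⊕ m)             ≡⟨ toℕ-⊕ (u ⊕ k) m ⟩
    (toℕ (u ⊕ k) + m) % n       ≡⟨ cong (λ x → (x + m) % n) (toℕ-⊕ u k) ⟩
    ((toℕ u + k) % n + m) % n   ≡⟨ [m%n+k]%n≡[m+k]%n (toℕ u + k) m n ⟩
    (toℕ u + k + m) % n         ≡⟨ cong (_% n) (+-assoc (toℕ u) k m) ⟩
    (toℕ u + (k + m)) % n       ≡⟨ toℕ-⊕ u (k + m) ⟨
    toℕ (u ⊕ (k + m))           ∎)
    where open ≡-Reasoning

  AddMod⇒≡⊕ : ∀ {s} u v → AddMod n s u v → v ≡ u ⊕ s
  AddMod⇒≡⊕ {s} u v e = toℕ-injective (sym (trans (toℕ-⊕ u s) (reduce e)))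
    where
    reduce : AddMod n s u v → (toℕ u + s) % n ≡ toℕ v
    reduce (inj₁ e) = trans (cong (_% n) e) (m<n⇒m%n≡m (toℕ<n v))
    reduce (inj₂ e) = trans (cong (_% n) e) (trans ([m+n]%n≡m%n (toℕ v) n) (m<n⇒m%n≡m (toℕ<n v)))

  AddMod-⊕ : ∀ {s} u → s ≤ n → AddMod n s u (u ⊕ s)
  AddMod-⊕ {s} u s≤n with toℕ u + s <? n
  ... | yes x<n = inj₁ (sym (trans (toℕ-⊕ u s) (m<n⇒m%n≡m x<n)))
  ... | no  x≮n = inj₂ (begin
    toℕ u + s                   ≡⟨ m∸n+n≡m n≤x ⟨
    (toℕ u + s ∸ n) + n         ≡⟨ cong (_+ n) wrapped ⟩
    toℕ (u ⊕ s) + n             ∎)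
    where
    open ≡-Reasoning
    n≤x = ≮⇒≥ x≮n
    wrapped : toℕ u + s ∸ n ≡ toℕ (u ⊕ s)
    wrapped = begin
      toℕ u + s ∸ n             ≡⟨ m<n⇒m%n≡m (m<n+o⇒m∸n<o (toℕ u + s) n (+-mono-<-≤ (toℕ<n u) s≤n)) ⟨
      (toℕ u + s ∸ n) % n       ≡⟨ m≤n⇒[n∸m]%m≡n%m n≤x ⟩
      (toℕ u + s) % n           ≡⟨ toℕ-⊕ u s ⟨
      toℕ (u ⊕ s)               ∎

  Reach-⊕ : ∀ {a} u m → Reach n a u (u ⊕ m) m
  Reach-⊕ u zero    = subst (λ w → Reach _ _ u w 0) (sym (⊕-identityʳ u)) here
  Reach-⊕ u (suc m) = step (inj₁ (AddMod-⊕ u (>-nonZero⁻¹ n)))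
    (subst (λ w → Reach _ _ (u ⊕ 1) w m) (⊕-assoc u 1 m) (Reach-⊕ (u ⊕ 1) m))

parity : ℕ → ℕ
parity zero          = 0
parity (suc zero)    = 1
parity (suc (suc k)) = parity k

parity<2 : ∀ k → parity k < 2
parity<2 zero          = s≤s z≤n
parity<2 (suc zero)    = ≤-refl
parity<2 (suc (suc k)) = parity<2 k

parity-suc : ∀ k → parity (suc k) ≢ parity k
parity-suc zero          ()
parity-suc (suc zero)    ()
parity-suc (suc (suc k)) = parity-suc k

[1+q]%3≢q : ∀ {q} → q < 3 → suc q % 3 ≢ q
[1+q]%3≢q (s≤s z≤n)               ()
[1+q]%3≢q (s≤s (s≤s z≤n))         ()
[1+q]%3≢q (s≤s (s≤s (s≤s z≤n)))   ()

mod3-trichotomy : ∀ {p q} → p < 3 → q < 3 → q ≡ p ⊎ q ≡ suc p % 3 ⊎ p ≡ suc q % 3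
mod3-trichotomy {0} {0} _ _ = inj₁ refl
mod3-trichotomy {1} {1} _ _ = inj₁ refl
mod3-trichotomy {2} {2} _ _ = inj₁ refl
mod3-trichotomy {0} {1} _ _ = inj₂ (inj₁ refl)
mod3-trichotomy {1} {2} _ _ = inj₂ (inj₁ refl)
mod3-trichotomy {2} {0} _ _ = inj₂ (inj₁ refl)
mod3-trichotomy {1} {0} _ _ = inj₂ (inj₂ refl)
mod3-trichotomy {2} {1} _ _ = inj₂ (inj₂ refl)
mod3-trichotomy {0} {2} _ _ = inj₂ (inj₂ refl)
mod3-trichotomy {suc (suc (suc _))} (s≤s (s≤s (s≤s ()))) _
mod3-trichotomy {_} {suc (suc (suc _))} _ (s≤s (s≤s (s≤s ())))

indicator : ∀ {n} → Subset n → Fin n → ℕ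
indicator S v = 𝟙 (lookup S v)

cost-indicator : ∀ {n} (S : Subset n) → cost n (indicator S) ≡ ∣ S ∣
cost-indicator {n} S = trans (cost≡∑ n (indicator S)) (sym (∣p∣≡∑ S))

independentSet⇒independentBroadcast : ∀ {n a S} → (∀ v → LeEcc n a 1 v) →
  IsIndependentSet n a S → IsIndependentBroadcast n a (indicator S)
independentSet⇒independentBroadcast {n} {a} {S} ecc≥1 independent = broadcast , apart
  where
  broadcast : IsBroadcast n a (indicator S)
  broadcast v = let u , far = ecc≥1 v in u , λ k r → ≤-trans (𝟙≤1 (lookup S v)) (far k r)
  member : ∀ {v} → 0 < indicator S v → v ∈ S
  member {v} p = lookup⇒[]= v S (𝟙-pos p)
  apart : ∀ u v → u ≢ v → 0 < indicator S u → 0 < indicator S v →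
          DistGt n a u v (indicator S u ⊔ indicator S v)
  apart u v u≢v pu pv r with Reach-1 (Reach-mono (⊔-lub (𝟙≤1 (lookup S u)) (𝟙≤1 (lookup S v))) r)
  ... | inj₁ u≡v = u≢v u≡v
  ... | inj₂ uv  = independent u v (member pu) (member pv) uv

module Circulant (a : ℕ) .{{_ : NonZero a}} where

  n : ℕ
  n = 3 * a

  instance
    n-nonZero : NonZero n
    n-nonZero = m*n≢0 3 a

  residue layer : Fin n → ℕ
  residue v = toℕ v % a
  layer   v = toℕ v / a

  residue<a : ∀ v → residue v < a
  residue<a v = m%n<n (toℕ v) a

  layer<3 : ∀ v → layer v < 3
  layer<3 v = m<n*o⇒m/o<n (toℕ<n v)

  toℕ≡residue+layer*a : ∀ v → toℕ v ≡ residue v + layer v * a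
  toℕ≡residue+layer*a v = m≡m%n+[m/n]*n (toℕ v) a

  residue-layer-injective : ∀ {u v} → residue u ≡ residue v → layer u ≡ layer v → u ≡ v
  residue-layer-injective {u} {v} r≡ q≡ = toℕ-injective (begin
    toℕ u                     ≡⟨ toℕ≡residue+layer*a u ⟩
    residue u + layer u * a   ≡⟨ cong₂ (λ r q → r + q * a) r≡ q≡ ⟩
    residue v + layer v * a   ≡⟨ toℕ≡residue+layer*a v ⟨
    toℕ v                     ∎)
    where open ≡-Reasoning

  coordinates : ∀ {v r q} → r < a → toℕ v ≡ r + q * a → residue v ≡ r × layer v ≡ q
  coordinates {v} {r} {q} r<a eq =
    trans (cong (_% a) eq) (trans ([m+kn]%n≡m%n r q a) (m<n⇒m%n≡m r<a)) ,
    trans (cong (_/ a) eq) ([m+kn]/n≡k q a r<a)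

  residue-⊕ : ∀ u m → residue (u ⊕ m) ≡ (residue u + m) % a
  residue-⊕ u m = begin
    toℕ (u ⊕ m) % a        ≡⟨ cong (_% a) (toℕ-⊕ u m) ⟩
    (toℕ u + m) % n % a    ≡⟨ m∣n⇒o%n%m≡o%m a n (toℕ u + m) (n∣m*n 3) ⟩
    (toℕ u + m) % a        ≡⟨ [m%n+k]%n≡[m+k]%n (toℕ u) m a ⟨
    (residue u + m) % a    ∎
    where open ≡-Reasoning

  layer-⊕ : ∀ u m → layer (u ⊕ m) ≡ (toℕ u + m) / a % 3
  layer-⊕ u m = trans (cong (_/ a) (toℕ-⊕ u m)) (m%[n*o]/o≡m/o%n (toℕ u + m) 3 a)

  residue-⊕a : ∀ u → residue (u ⊕ a) ≡ residue u
  residue-⊕a u = trans (residue-⊕ u a) (trans ([m+n]%n≡m%n (residue u) a) (m%n%n≡m%n (toℕ u) a))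

  layer-⊕a : ∀ u → layer (u ⊕ a) ≡ suc (layer u) % 3
  layer-⊕a u = trans (layer-⊕ u a) (cong (_% 3) (begin
    (toℕ u + a) / a    ≡⟨ +-distrib-/-∣ʳ (toℕ u) ∣-refl ⟩
    layer u + a / a    ≡⟨ cong (layer u +_) (n/n≡1 a) ⟩
    layer u + 1        ≡⟨ +-comm (layer u) 1 ⟩
    suc (layer u)      ∎))
    where open ≡-Reasoning

  Adj-⊕a : ∀ u → Adj n a u (u ⊕ a)
  Adj-⊕a u = inj₂ (inj₂ (inj₁ (AddMod-⊕ u (m≤n*m a 3))))

  ⊕a≢ : ∀ (u : Fin n) → u ⊕ a ≢ u
  ⊕a≢ u eq = [1+q]%3≢q (layer<3 u) (trans (sym (layer-⊕a u)) (cong layer eq))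

  Reach-nextLayer : ∀ {u v} → residue u ≡ residue v → layer v ≡ suc (layer u) % 3 → Reach n a u v 1
  Reach-nextLayer {u} r≡ up = step (subst (Adj n a u) v≡u⊕a (Adj-⊕a u)) here
    where
    v≡u⊕a = residue-layer-injective (trans (residue-⊕a u) r≡) (trans (layer-⊕a u) (sym up))

  Reach-sameResidue : ∀ {u v} → residue u ≡ residue v → Reach n a u v 1
  Reach-sameResidue {u} {v} r≡ with mod3-trichotomy (layer<3 u) (layer<3 v)
  ... | inj₁ q≡          = subst (λ w → Reach n a u w 1) (residue-layer-injective r≡ (sym q≡)) here
  ... | inj₂ (inj₁ up)   = Reach-nextLayer r≡ up
  ... | inj₂ (inj₂ down) = Reach-sym (Reach-nextLayer (sym r≡) down)

  Reach-residue : ∀ {u v} m → (residue u + m) % a ≡ residue v → Reach n a u v (suc m)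
  Reach-residue {u} m eq = Reach-mono (≤-reflexive (+-comm m 1))
    (Reach-trans (Reach-⊕ u m) (Reach-sameResidue (trans (residue-⊕ u m) eq)))

  distance≤a : ∀ u v → Reach n a u v a
  distance≤a u v = Reach-mono (m%n<n gap a) (Reach-residue (gap % a) closes)
    where
    open ≡-Reasoning
    gap = a ∸ residue u + residue v
    closes : (residue u + gap % a) % a ≡ residue v
    closes = begin
      (residue u + gap % a) % a  ≡⟨ cong (_% a) (+-comm (residue u) (gap % a)) ⟩
      (gap % a + residue u) % a  ≡⟨ [m%n+k]%n≡[m+k]%n gap (residue u) a ⟩
      (gap + residue u) % a      ≡⟨ cong (_% a) (+-comm gap (residue u)) ⟩
      (residue u + gap) % a      ≡⟨ cong (_% a) (+-assoc (residue u) (a ∸ residue u) (residue v)) ⟨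
      (residue u + (a ∸ residue u) + residue v) % a
                                 ≡⟨ cong (λ x → (x + residue v) % a) (m+[n∸m]≡n (<⇒≤ (residue<a u))) ⟩
      (a + residue v) % a        ≡⟨ %-remove-+ˡ (residue v) ∣-refl ⟩
      residue v % a              ≡⟨ m%n%n≡m%n (toℕ v) a ⟩
      residue v                  ∎

  eccentricity≥1 : ∀ v → LeEcc n a 1 v
  eccentricity≥1 v = v ⊕ a , λ { zero r → ⊥-elim (⊕a≢ v (sym (Reach-0 r))) ; (suc _) _ → s≤s z≤n }

  broadcast≤a : ∀ {f} → IsBroadcast n a f → ∀ v → f v ≤ a
  broadcast≤a isBroadcast v = let u , far = isBroadcast v in far a (distance≤a v u)

  cover : (f : Fin n → ℕ) (v : Fin n) → Fin (f v) → ℕ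
  cover f v i = (residue v + toℕ i) % a

  cover-injective-≤ : ∀ {f} → IsIndependentBroadcast n a f → ∀ u v i j → toℕ j ≤ toℕ i →
                      cover f u i ≡ cover f v j → u ≡ v × toℕ i ≡ toℕ j
  cover-injective-≤ {f} (isBroadcast , apart) u v i j j≤i eq = u≡v , ≤-antisym (m∸n≡0⇒m≤n d≡0) j≤i
    where
    d = toℕ i ∸ toℕ j
    shift : (residue u + d) % a ≡ residue v
    shift = trans (%-cancelʳ-+ (toℕ j) a (trans (cong (_% a) undo) eq)) (m%n%n≡m%n (toℕ v) a)
      where
      undo : residue u + d + toℕ j ≡ residue u + toℕ i
      undo = trans (+-assoc (residue u) d (toℕ j)) (cong (residue u +_) (m∸n+n≡m j≤i))
    positive : ∀ {w} → Fin (f w) → 0 < f w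
    positive k = ≤-<-trans z≤n (toℕ<n k)
    close : suc d ≤ f u ⊔ f v
    close = ≤-trans (s≤s (m∸n≤m (toℕ i) (toℕ j))) (≤-trans (toℕ<n i) (m≤m⊔n (f u) (f v)))
    u≡v : u ≡ v
    u≡v with u Fin.≟ v
    ... | yes u≡v = u≡v
    ... | no  u≢v = ⊥-elim (apart u v u≢v (positive i) (positive j)
                                (Reach-mono close (Reach-residue d shift)))
    d≡0 : d ≡ 0
    d≡0 = [m+d]%n≡m%n⇒d≡0 (residue u) a d<a
            (trans shift (trans (cong residue (sym u≡v)) (sym (m%n%n≡m%n (toℕ u) a))))
      where
      d<a = ≤-<-trans (m∸n≤m (toℕ i) (toℕ j)) (<-≤-trans (toℕ<n i) (broadcast≤a isBroadcast u))

  cover-injective : ∀ {f} → IsIndependentBroadcast n a f → ∀ u v i j →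
                    cover f u i ≡ cover f v j → u ≡ v × toℕ i ≡ toℕ j
  cover-injective ib u v i j eq with ≤-total (toℕ j) (toℕ i)
  ... | inj₁ j≤i = cover-injective-≤ ib u v i j j≤i eq
  ... | inj₂ i≤j = Data.Product.map sym sym (cover-injective-≤ ib v u j i i≤j (sym eq))

  independentBroadcast⇒cost≤a : ∀ {f} → IsIndependentBroadcast n a f → cost n f ≤ a
  independentBroadcast⇒cost≤a {f} ib =
    subst (_≤ a) (sym (cost≡∑ n f)) (∑-≤-disjoint f (cover f) (λ v i → m%n<n _ a) (cover-injective ib))

  IsZigzag : Fin n → Set
  IsZigzag v = layer v ≡ parity (residue v)

  isZigzag? : ∀ v → Dec (IsZigzag v)
  isZigzag? v = layer v ≟ parity (residue v)

  zigzag : Subset n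
  zigzag = tabulate (does ∘ isZigzag?)

  ∈zigzag⇒ : ∀ {v} → v ∈ zigzag → IsZigzag v
  ∈zigzag⇒ = ∈-tabulate⁻ isZigzag?

  toℕ+1 : ∀ u → toℕ u + 1 ≡ suc (residue u) + layer u * a
  toℕ+1 u = trans (+-comm (toℕ u) 1) (cong suc (toℕ≡residue+layer*a u))

  ⊕1-inLayer : ∀ u → suc (residue u) < a → residue (u ⊕ 1) ≡ suc (residue u) × layer (u ⊕ 1) ≡ layer u
  ⊕1-inLayer u r+1<a =
    trans (residue-⊕ u 1) (trans (cong (_% a) (+-comm (residue u) 1)) (m<n⇒m%n≡m r+1<a)) ,
    (begin
      layer (u ⊕ 1)                               ≡⟨ layer-⊕ u 1 ⟩
      (toℕ u + 1) / a % 3                         ≡⟨ cong (λ x → x / a % 3) (toℕ+1 u) ⟩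
      (suc (residue u) + layer u * a) / a % 3     ≡⟨ cong (_% 3) ([m+kn]/n≡k (layer u) a r+1<a) ⟩
      layer u % 3                                 ≡⟨ m<n⇒m%n≡m (layer<3 u) ⟩
      layer u                                     ∎)
    where open ≡-Reasoning

  ⊕1-wrap : ∀ u → suc (residue u) ≡ a → residue (u ⊕ 1) ≡ 0 × layer (u ⊕ 1) ≡ suc (layer u) % 3
  ⊕1-wrap u r+1≡a =
    trans (residue-⊕ u 1) (trans (cong (_% a) (trans (+-comm (residue u) 1) r+1≡a)) (n%n≡0 a)) ,
    (begin
      layer (u ⊕ 1)                               ≡⟨ layer-⊕ u 1 ⟩
      (toℕ u + 1) / a % 3                         ≡⟨ cong (λ x → x / a % 3) (toℕ+1 u) ⟩
      (suc (residue u) + layer u * a) / a % 3     ≡⟨ cong (λ r → (r + layer u * a) / a % 3) r+1≡a ⟩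
      suc (layer u) * a / a % 3                   ≡⟨ cong (_% 3) (m*n/n≡m (suc (layer u)) a) ⟩
      suc (layer u) % 3                           ∎)
    where open ≡-Reasoning

  IsZigzag-⊕1 : ∀ {u} → IsZigzag u → ¬ IsZigzag (u ⊕ 1)
  IsZigzag-⊕1 {u} zu zu⊕1 with suc (residue u) <? a
  ... | yes r+1<a = parity-suc (residue u) (begin
      parity (suc (residue u))      ≡⟨ cong parity (proj₁ inLayer) ⟨
      parity (residue (u ⊕ 1))      ≡⟨ zu⊕1 ⟨
      layer (u ⊕ 1)                 ≡⟨ proj₂ inLayer ⟩
      layer u                       ≡⟨ zu ⟩
      parity (residue u)            ∎)
    where
    open ≡-Reasoning
    inLayer = ⊕1-inLayer u r+1<a
  ... | no r+1≮a = 0≢1+n (begin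
      0                             ≡⟨ cong parity (proj₁ wrap) ⟨
      parity (residue (u ⊕ 1))      ≡⟨ zu⊕1 ⟨
      layer (u ⊕ 1)                 ≡⟨ proj₂ wrap ⟩
      suc (layer u) % 3             ≡⟨ m<n⇒m%n≡m (s≤s (subst (_< 2) (sym zu) (parity<2 (residue u)))) ⟩
      suc (layer u)                 ∎)
    where
    open ≡-Reasoning
    wrap = ⊕1-wrap u (≤-antisym (residue<a u) (≮⇒≥ r+1≮a))

  IsZigzag-⊕a : ∀ {u} → IsZigzag u → ¬ IsZigzag (u ⊕ a)
  IsZigzag-⊕a {u} zu zu⊕a = [1+q]%3≢q (layer<3 u) (begin
    suc (layer u) % 3       ≡⟨ layer-⊕a u ⟨
    layer (u ⊕ a)           ≡⟨ zu⊕a ⟩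
    parity (residue (u ⊕ a)) ≡⟨ cong parity (residue-⊕a u) ⟩
    parity (residue u)      ≡⟨ zu ⟨
    layer u                 ∎)
    where open ≡-Reasoning

  zigzag-noEdge : ∀ {u v} → IsZigzag u → IsZigzag v → ¬ Adj n a u v
  zigzag-noEdge {u} {v} zu zv (inj₁ e)               = IsZigzag-⊕1 zu (subst IsZigzag (AddMod⇒≡⊕ u v e) zv)
  zigzag-noEdge {u} {v} zu zv (inj₂ (inj₁ e))        = IsZigzag-⊕1 zv (subst IsZigzag (AddMod⇒≡⊕ v u e) zu)
  zigzag-noEdge {u} {v} zu zv (inj₂ (inj₂ (inj₁ e))) = IsZigzag-⊕a zu (subst IsZigzag (AddMod⇒≡⊕ u v e) zv)
  zigzag-noEdge {u} {v} zu zv (inj₂ (inj₂ (inj₂ e))) = IsZigzag-⊕a zv (subst IsZigzag (AddMod⇒≡⊕ v u e) zu)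

  zigzag-independent : IsIndependentSet n a zigzag
  zigzag-independent u v u∈ v∈ = zigzag-noEdge (∈zigzag⇒ u∈) (∈zigzag⇒ v∈)

  combine-coordinates : ∀ (i : Fin 3) (j : Fin a) → residue (combine i j) ≡ toℕ j × layer (combine i j) ≡ toℕ i
  combine-coordinates i j = coordinates (toℕ<n j) (begin
    toℕ (combine i j)       ≡⟨ toℕ-combine i j ⟩
    a * toℕ i + toℕ j       ≡⟨ +-comm (a * toℕ i) (toℕ j) ⟩
    toℕ j + a * toℕ i       ≡⟨ cong (toℕ j +_) (*-comm a (toℕ i)) ⟩
    toℕ j + toℕ i * a       ∎)
    where open ≡-Reasoning

  ∣zigzag∣≡a : ∣ zigzag ∣ ≡ a
  ∣zigzag∣≡a = begin
    ∣ zigzag ∣                                                ≡⟨ ∣p∣≡∑ zigzag ⟩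
    ∑[ v < n ] 𝟙 (lookup zigzag v)                            ≡⟨ sum-cong-≗ (cong 𝟙 ∘ lookup∘tabulate (does ∘ isZigzag?)) ⟩
    ∑[ v < n ] member v                                       ≡⟨ ∑-combine 3 {a} member ⟩
    ∑[ i < 3 ] ∑[ j < a ] member (combine i j)                ≡⟨ sum-cong-≗ {3} (λ i → sum-cong-≗ {a} (in-coordinates i)) ⟩
    ∑[ i < 3 ] ∑[ j < a ] 𝟙 (does (toℕ i ≟ parity (toℕ j)))  ≡⟨ ∑-comm {3} {a} (λ i j → 𝟙 (does (toℕ i ≟ parity (toℕ j)))) ⟩
    ∑[ j < a ] ∑[ i < 3 ] 𝟙 (does (toℕ i ≟ parity (toℕ j)))  ≡⟨ sum-cong-≗ {a} (λ j → ∑-δ {3} (m<n⇒m<1+n (parity<2 (toℕ j)))) ⟩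
    ∑[ j < a ] 1                                              ≡⟨ ∑-const-1 a ⟩
    a                                                         ∎
    where
    open ≡-Reasoning
    member : Fin n → ℕ
    member v = 𝟙 (does (isZigzag? v))
    in-coordinates : ∀ (i : Fin 3) (j : Fin a) → member (combine i j) ≡ 𝟙 (does (toℕ i ≟ parity (toℕ j)))
    in-coordinates i j = let r≡ , q≡ = combine-coordinates i j in
      cong₂ (λ q r → 𝟙 (does (q ≟ parity r))) q≡ r≡

theorem5 : (a : ℕ) → 3 ≤ a → BroadcastIndepNumber (3 * a) a a × IndepNumber (3 * a) a a
theorem5 a@(suc _) _ =
  ((indicator zigzag , asBroadcast zigzag-independent , trans (cost-indicator zigzag) ∣zigzag∣≡a) ,
   λ _ → independentBroadcast⇒cost≤a) ,
  ((zigzag , zigzag-independent , ∣zigzag∣≡a) , independentSet⇒size≤a)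
  where
  open Circulant a
  asBroadcast : ∀ {S} → IsIndependentSet n a S → IsIndependentBroadcast n a (indicator S)
  asBroadcast = independentSet⇒independentBroadcast eccentricity≥1
  independentSet⇒size≤a : ∀ S → IsIndependentSet n a S → ∣ S ∣ ≤ a
  independentSet⇒size≤a S independent =
    subst (_≤ a) (cost-indicator S) (independentBroadcast⇒cost≤a (asBroadcast independent))
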